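{- Let $\mathbf{Acyc}_n=\{Q\in\mathrm{Quiv}_n : b_{ij}(Q)\ge 2 \text{ for all } i<j\}$. Fix a mutation sequence $i_1,\dots,i_m$ of vertices in $[1,n]$, and let $\mu[\mathbf{i}]:\mathrm{Quiv}_n\to\mathrm{Quiv}_n$ be the map mutating successively at these vertices. Then the restriction of $\mu[\mathbf{i}]$ to $\mathbf{Acyc}_n$ is a $\mathbb{Z}$-biregular map onto its image.
   Context: A quiver on $[1,n]$ is a finite directed multigraph with no loops and no oriented 2-cycles, encoded by the skew-symmetric integer matrix $B(Q)=(b_{ij})$, $b_{ij}>0$ meaning $b_{ij}$ arrows from $i$ to $j$; mutation at $k$: $b'_{ij}=-b_{ij}$ if $k\in\{i,j\}$, else $b'_{ij}=b_{ij}+\tfrac12(|b_{ik}|b_{kj}+b_{ik}|b_{kj}|)$. $\mathrm{Quiv}_n$ denotes the set of all quivers on $[1,n]$, identified with $\mathbb{Z}^{\binom n2}$ via $Q\mapsto(b_{ij}(Q))_{1\le i<j\le n}$. For $A,B\subseteq\mathbb{Z}^d$, a map $f:A\to B$ is $\mathbb{Z}$-biregular if it is a bijection and both $f$ and $f^{ -1}$ are given by polynomials with integer coefficients in the coordinates. -}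

module Defs where

open import Data.Nat using (ℕ)
open import Data.Integer using (ℤ; +_; -_; _+_; _*_; _≥_; ∣_∣)
open import Data.Integer.DivMod using (_/_)
open import Data.Fin using (Fin; _<_)
open import Data.Fin.Properties using (<-cmp)
open import Data.Product using (Σ; _×_; _,_; proj₁; proj₂)
open import Data.List using (List; foldl)
open import Data.Empty using (⊥)
open import Relation.Binary.Definitions using (tri<; tri≈; tri>)
open import Relation.Binary.PropositionalEquality using (_≡_)
open import Relation.Nullary using (yes; no)
open import Data.Fin using (_≟_)

-- Polynomials with integer coefficients in variables indexed by V
-- (as formal expressions; every such expression evaluates to a
-- polynomial function and every integer polynomial is such an expression).

data Poly (V : Set) : Set where
  var  : V → Poly V
  con  : ℤ → Poly V
  _⊕_  : Poly V → Poly V → Poly V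
  _⊗_  : Poly V → Poly V → Poly V

eval : {V : Set} → Poly V → (V → ℤ) → ℤ
eval (var v) x = x v
eval (con c) x = c
eval (p ⊕ q) x = eval p x + eval q x
eval (p ⊗ q) x = eval p x * eval q x

-- A ⊆ ℤ^V, f : ℤ^V → ℤ^W.
-- f|A : A → f(A) is a bijection whose components are integer
-- polynomials, and whose inverse f(A) → A is given by integer
-- polynomials.  (Injectivity on A follows from the inverse equation;
-- surjectivity onto f(A) is by definition of the image.)

ZBiregularOntoImage : {V W : Set} → ((V → ℤ) → Set) → ((V → ℤ) → (W → ℤ)) → Set
ZBiregularOntoImage {V} {W} A f =
  Σ (W → Poly V) λ F → Σ (V → Poly W) λ G →
    ((x : V → ℤ) → A x → (w : W) → f x w ≡ eval (F w) x) ×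
    ((x : V → ℤ) → A x → (v : V) → eval (G v) (f x) ≡ x v)

-- Quivers on [1,n], identified with ℤ^{(n choose 2)}: a quiver is the
-- vector of coordinates b_ij for i < j (indexed by such pairs).

Pair : ℕ → Set
Pair n = Σ (Fin n × Fin n) λ p → proj₁ p < proj₂ p

Quiv : ℕ → Set
Quiv n = Pair n → ℤ

mat : {n : ℕ} → Quiv n → Fin n → Fin n → ℤ
mat Q i j with <-cmp i j
... | tri< i<j _ _ = Q ((i , j) , i<j)
... | tri≈ _ _ _   = + 0
... | tri> _ _ j<i = - Q ((j , i) , j<i)

absℤ : ℤ → ℤ
absℤ a = + ∣ a ∣

mutate : {n : ℕ} → Fin n → Quiv n → Quiv n
mutate k Q ((i , j) , _) with k ≟ i | k ≟ j
... | yes _ | _     = - mat Q i j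
... | no _  | yes _ = - mat Q i j
... | no _  | no _  =
  mat Q i j + ((absℤ (mat Q i k) * mat Q k j + mat Q i k * absℤ (mat Q k j)) / + 2)

mutSeq : {n : ℕ} → List (Fin n) → Quiv n → Quiv n
mutSeq is Q = foldl (λ R k → mutate k R) Q is

Acyc : (n : ℕ) → Quiv n → Set
Acyc n Q = (p : Pair n) → Q p ≥ + 2

module Submission where

-- Call a quiver abundant when |b_ij| ≥ 2 for all i ≠ j.  If the signs of an abundant quiver are
-- known, mutation at k is an integer polynomial map: b'_ij is b_ij + b_ik b_kj along a path
-- i → k → j, b_ij − b_ik b_kj along j → k → i, b_ij otherwise, and −b_ij on the edges at k.
-- Starting in Acyc_n these signs depend on the mutation word only.  By Warkentin's theory of
-- forks, mutating an acyclic quiver, or a fork at a vertex other than its point of return,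
-- yields a fork whose point of return is the mutated vertex and whose orientation is computed
-- from the previous one, while mutating at the point of return undoes the last step.  So μ[i]
-- is a composite of polynomial maps on Acyc_n, and since mutation is an involution the
-- reversed composite is a polynomial inverse on the image.

open import Defs
open import Data.Bool using (Bool; true; false; not)
open import Data.Empty using (⊥; ⊥-elim)
open import Data.Fin using (Fin; _≟_)
import Data.Fin as Fin
import Data.Fin.Properties as Fin
open import Data.Integer hiding (_≟_)
open import Data.Integer.Properties hiding (_≟_)
open import Data.List using (List; []; _∷_)
open import Data.Nat using (ℕ)
import Data.Nat as ℕ
import Data.Nat.Properties as ℕₚ
open import Data.Nat.DivMod using (m*n/n≡m; m*n%n≡0)
open import Data.Product using (_×_; _,_; proj₁; proj₂)
open import Data.Sum using (_⊎_; inj₁; inj₂)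
open import Function using (_∘_)
open import Relation.Binary.Definitions using (tri<; tri≈; tri>)
open import Relation.Binary.PropositionalEquality
open import Relation.Nullary using (yes; no; does)
open import Relation.Nullary.Decidable using (dec-true; dec-false)

private
  variable
    n : ℕ
    V W : Set

exchangeTerm : ℤ → ℤ → ℤ
exchangeTerm a b = (absℤ a * b + a * absℤ b) / + 2

exchangeTermᶜ : ℤ → ℤ → ℤ
exchangeTermᶜ (+ m)    (+ n)    = + m * + n
exchangeTermᶜ -[1+ m ] -[1+ n ] = -[1+ m ] * + ℕ.suc n
exchangeTermᶜ _        _        = 0ℤ

m+m≡m*2 : ∀ m → m ℕ.+ m ≡ m ℕ.* 2
m+m≡m*2 m = trans (cong (m ℕ.+_) (sym (ℕₚ.*-identityʳ m))) (sym (ℕₚ.*-suc m 1))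

2+m+m≡[1+m]*2 : ∀ m → ℕ.suc (ℕ.suc (m ℕ.+ m)) ≡ ℕ.suc m ℕ.* 2
2+m+m≡[1+m]*2 m = trans (cong ℕ.suc (sym (ℕₚ.+-suc m m))) (m+m≡m*2 (ℕ.suc m))

[i+i]/2≡i : ∀ i → (i + i) / + 2 ≡ i
[i+i]/2≡i (+ m) =
  trans (*-identityˡ _) (cong +_ (trans (cong (ℕ._/ 2) (m+m≡m*2 m)) (m*n/n≡m m 2)))
-- On negative dividends _/ℕ_ branches on the remainder, which has to be computed first.
[i+i]/2≡i -[1+ m ]
  rewrite trans (cong (ℕ._% 2) (2+m+m≡[1+m]*2 m)) (m*n%n≡0 (ℕ.suc m) 2) =
  trans (*-identityˡ _) (cong (-_ ∘ +_) (trans (cong (ℕ._/ 2) (2+m+m≡[1+m]*2 m)) (m*n/n≡m (ℕ.suc m) 2)))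

exchangeTerm≡exchangeTermᶜ : ∀ a b → exchangeTerm a b ≡ exchangeTermᶜ a b
exchangeTerm≡exchangeTermᶜ a b = trans (cong (_/ + 2) (twice a b)) ([i+i]/2≡i (exchangeTermᶜ a b))
  where
  twice : ∀ a b → absℤ a * b + a * absℤ b ≡ exchangeTermᶜ a b + exchangeTermᶜ a b
  twice (+ m)    (+ n)    = refl
  twice -[1+ m ] -[1+ n ] = refl
  twice (+ m)    -[1+ n ] =
    trans (sym (*-distribˡ-+ (+ m) -[1+ n ] (+ ℕ.suc n)))
          (trans (cong (+ m *_) (+-inverseˡ (+ ℕ.suc n))) (*-zeroʳ (+ m)))
  twice -[1+ m ] (+ n)    =
    trans (sym (*-distribʳ-+ (+ n) (+ ℕ.suc m) -[1+ m ])) (cong (_* + n) (+-inverseʳ (+ ℕ.suc m)))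

exchangeTerm-comm : ∀ a b → exchangeTerm a b ≡ exchangeTerm b a
exchangeTerm-comm a b =
  trans (exchangeTerm≡exchangeTermᶜ a b) (trans (comm a b) (sym (exchangeTerm≡exchangeTermᶜ b a)))
  where
  comm : ∀ a b → exchangeTermᶜ a b ≡ exchangeTermᶜ b a
  comm (+ m)    (+ n)    = *-comm (+ m) (+ n)
  comm -[1+ m ] -[1+ n ] =
    trans (sym (neg-distribˡ-* (+ ℕ.suc m) (+ ℕ.suc n)))
          (trans (cong -_ (*-comm (+ ℕ.suc m) (+ ℕ.suc n))) (neg-distribˡ-* (+ ℕ.suc n) (+ ℕ.suc m)))
  comm (+ m)    -[1+ n ] = refl
  comm -[1+ m ] (+ n)    = refl

exchangeTerm-neg : ∀ a b → exchangeTerm (- a) (- b) ≡ - exchangeTerm a b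
exchangeTerm-neg a b =
  trans (exchangeTerm≡exchangeTermᶜ (- a) (- b))
        (trans (negation a b) (cong -_ (sym (exchangeTerm≡exchangeTermᶜ a b))))
  where
  negation : ∀ a b → exchangeTermᶜ (- a) (- b) ≡ - exchangeTermᶜ a b
  negation +0       +0       = refl
  negation +0       +[1+ n ] = refl
  negation +0       -[1+ n ] = refl
  negation +[1+ m ] +0       = sym (cong -_ (*-zeroʳ +[1+ m ]))
  negation +[1+ m ] +[1+ n ] = neg-distribˡ-* +[1+ m ] +[1+ n ]
  negation +[1+ m ] -[1+ n ] = refl
  negation -[1+ m ] +0       = *-zeroʳ +[1+ m ]
  negation -[1+ m ] +[1+ n ] = refl
  negation -[1+ m ] -[1+ n ] = sym (neg-distribˡ-* -[1+ m ] +[1+ n ])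

exchangeTerm-i-[-i] : ∀ a → exchangeTerm a (- a) ≡ 0ℤ
exchangeTerm-i-[-i] a = trans (exchangeTerm≡exchangeTermᶜ a (- a)) (anti a)
  where
  anti : ∀ a → exchangeTermᶜ a (- a) ≡ 0ℤ
  anti +0       = refl
  anti +[1+ m ] = refl
  anti -[1+ m ] = refl

Sign : Bool → ℤ → Set
Sign true  x = + 2 ≤ x
Sign false x = + 2 ≤ - x

sign-not : ∀ b {x} → Sign b x → Sign (not b) (- x)
sign-not true  p = subst (+ 2 ≤_) (sym (neg-involutive _)) p
sign-not false p = p

sign-exclusive : ∀ {x} → Sign true x → Sign false x → ⊥
sign-exclusive p q with ≤-trans q (neg-mono-≤ p)
... | ()

exchangeTermOfSigns : Bool → Bool → ℤ → ℤ → ℤ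
exchangeTermOfSigns true  true  x y = x * y
exchangeTermOfSigns false false x y = -1ℤ * (x * y)
exchangeTermOfSigns _     _     _ _ = 0ℤ

exchangeTerm-sign : ∀ b₁ b₂ {x y} → Sign b₁ x → Sign b₂ y →
                    exchangeTerm x y ≡ exchangeTermOfSigns b₁ b₂ x y
exchangeTerm-sign b₁ b₂ {x} {y} p q = trans (exchangeTerm≡exchangeTermᶜ x y) (signs b₁ b₂ p q)
  where
  signs : ∀ b₁ b₂ {x y} → Sign b₁ x → Sign b₂ y →
          exchangeTermᶜ x y ≡ exchangeTermOfSigns b₁ b₂ x y
  signs true  true  {+ _}      {+ _}      _ _ = refl
  signs true  false {+ _}      { -[1+ _ ]} _ _ = refl
  signs false true  { -[1+ _ ]} {+ _}      _ _ = refl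
  signs false false { -[1+ m ]} { -[1+ n ]} _ _ =
    trans (sym (neg-distribʳ-* -[1+ m ] -[1+ n ])) (sym (-1*i≡-i _))
  signs true  _     { -[1+ _ ]} () _
  signs false _     {+0}       (+≤+ ()) _
  signs false _     {+[1+ _ ]} () _
  signs _     true  {_} { -[1+ _ ]} _ ()
  signs _     false {_} {+0}       _ (+≤+ ())
  signs _     false {_} {+[1+ _ ]} _ ()

i<k+i*j : ∀ {i j k} → + 0 ≤ i → + 2 ≤ j → - i < k → i < k + i * j
i<k+i*j {i} {j} {k} 0≤i 2≤j -i<k = begin-strict
  i               ≡⟨ -i+[i+i]≡i ⟨
  - i + (i + i)   <⟨ +-monoˡ-< (i + i) -i<k ⟩
  k + (i + i)     ≡⟨ cong (_+_ k) i+i≡i*2 ⟩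
  k + i * + 2     ≤⟨ +-monoʳ-≤ k (*-monoˡ-≤-nonNeg i ⦃ nonNegative 0≤i ⦄ 2≤j) ⟩
  k + i * j       ∎
  where
  open ≤-Reasoning
  -i+[i+i]≡i : - i + (i + i) ≡ i
  -i+[i+i]≡i = trans (sym (+-assoc (- i) i i)) (trans (cong (_+ i) (+-inverseˡ i)) (+-identityˡ i))
  i+i≡i*2 : i + i ≡ i * + 2
  i+i≡i*2 = trans (sym (cong₂ _+_ (*-identityʳ i) (*-identityʳ i))) (sym (*-distribˡ-+ i 1ℤ 1ℤ))

-i<j : ∀ {i j} → + 2 ≤ i → + 0 ≤ j → - i < j
-i<j {+[1+ _ ]} {+ _} _        _ = -<+
-i<j {+0}       {_}   (+≤+ ()) _

Matrix : ℕ → Set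
Matrix n = Fin n → Fin n → ℤ

infix 4 _≗₂_
_≗₂_ : Matrix n → Matrix n → Set
M ≗₂ N = ∀ i j → M i j ≡ N i j

SkewSymmetric : Matrix n → Set
SkewSymmetric M = ∀ i j → M j i ≡ - M i j

mutateMatrix : Fin n → Matrix n → Matrix n
mutateMatrix k M i j with k ≟ i | k ≟ j
... | yes _ | _     = - M i j
... | no _  | yes _ = - M i j
... | no _  | no _  = M i j + exchangeTerm (M i k) (M k j)

module _ (k : Fin n) (M : Matrix n) where

  mutateMatrix-row : ∀ j → mutateMatrix k M k j ≡ - M k j
  mutateMatrix-row j with k ≟ k
  ... | yes _   = refl
  ... | no k≢k = ⊥-elim (k≢k refl)

  mutateMatrix-col : ∀ i → mutateMatrix k M i k ≡ - M i k
  mutateMatrix-col i with k ≟ i | k ≟ k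
  ... | yes _ | _       = refl
  ... | no _  | yes _   = refl
  ... | no _  | no k≢k = ⊥-elim (k≢k refl)

  mutateMatrix-off : ∀ {i j} → k ≢ i → k ≢ j →
                     mutateMatrix k M i j ≡ M i j + exchangeTerm (M i k) (M k j)
  mutateMatrix-off {i} {j} k≢i k≢j with k ≟ i | k ≟ j
  ... | yes k≡i | _       = ⊥-elim (k≢i k≡i)
  ... | no _    | yes k≡j = ⊥-elim (k≢j k≡j)
  ... | no _    | no _    = refl

  mutateMatrix-involutive : mutateMatrix k (mutateMatrix k M) ≗₂ M
  mutateMatrix-involutive i j with k ≟ i | k ≟ j
  ... | yes refl | _       = trans (cong -_ (mutateMatrix-row j)) (neg-involutive (M k j))
  ... | no _     | yes refl = trans (cong -_ (mutateMatrix-col i)) (neg-involutive (M i k))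
  ... | no k≢i   | no k≢j  = begin
    mutateMatrix k M i j + exchangeTerm (mutateMatrix k M i k) (mutateMatrix k M k j)
      ≡⟨ cong₂ (λ u v → u + exchangeTerm v (mutateMatrix k M k j))
               (mutateMatrix-off k≢i k≢j) (mutateMatrix-col i) ⟩
    M i j + exchangeTerm (M i k) (M k j) + exchangeTerm (- M i k) (mutateMatrix k M k j)
      ≡⟨ cong (λ v → M i j + exchangeTerm (M i k) (M k j) + exchangeTerm (- M i k) v) (mutateMatrix-row j) ⟩
    M i j + exchangeTerm (M i k) (M k j) + exchangeTerm (- M i k) (- M k j)
      ≡⟨ cong (_+_ (M i j + exchangeTerm (M i k) (M k j))) (exchangeTerm-neg (M i k) (M k j)) ⟩
    M i j + exchangeTerm (M i k) (M k j) - exchangeTerm (M i k) (M k j)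
      ≡⟨ +-assoc (M i j) _ _ ⟩
    M i j + (exchangeTerm (M i k) (M k j) - exchangeTerm (M i k) (M k j))
      ≡⟨ cong (_+_ (M i j)) (+-inverseʳ (exchangeTerm (M i k) (M k j))) ⟩
    M i j + 0ℤ
      ≡⟨ +-identityʳ (M i j) ⟩
    M i j ∎
    where open ≡-Reasoning

  module _ (skew : SkewSymmetric M) where

    mutateMatrix-skew : SkewSymmetric (mutateMatrix k M)
    mutateMatrix-skew i j with k ≟ i | k ≟ j
    ... | yes _ | yes _ = cong -_ (skew i j)
    ... | yes _ | no _  = cong -_ (skew i j)
    ... | no _  | yes _ = cong -_ (skew i j)
    ... | no _  | no _  = begin
      M j i + exchangeTerm (M j k) (M k i)      ≡⟨ cong₂ (λ u v → u + exchangeTerm v (M k i)) (skew i j) (skew k j) ⟩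
      - M i j + exchangeTerm (- M k j) (M k i)  ≡⟨ cong (λ v → - M i j + exchangeTerm (- M k j) v) (skew i k) ⟩
      - M i j + exchangeTerm (- M k j) (- M i k) ≡⟨ cong (_+_ (- M i j)) (exchangeTerm-neg (M k j) (M i k)) ⟩
      - M i j - exchangeTerm (M k j) (M i k)    ≡⟨ cong (λ v → - M i j - v) (exchangeTerm-comm (M k j) (M i k)) ⟩
      - M i j - exchangeTerm (M i k) (M k j)    ≡⟨ neg-distrib-+ (M i j) _ ⟨
      - (M i j + exchangeTerm (M i k) (M k j))  ∎
      where open ≡-Reasoning

    mutateMatrix-diag : ∀ i → M i i ≡ 0ℤ → mutateMatrix k M i i ≡ 0ℤ
    mutateMatrix-diag i Mii≡0 with k ≟ i
    ... | yes _ = cong -_ Mii≡0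
    ... | no _  = begin
      M i i + exchangeTerm (M i k) (M k i)      ≡⟨ cong₂ (λ u v → u + exchangeTerm (M i k) v) Mii≡0 (skew i k) ⟩
      0ℤ + exchangeTerm (M i k) (- M i k)       ≡⟨ +-identityˡ _ ⟩
      exchangeTerm (M i k) (- M i k)            ≡⟨ exchangeTerm-i-[-i] (M i k) ⟩
      0ℤ                                         ∎
      where open ≡-Reasoning

mutateMatrix-cong : ∀ k {M N : Matrix n} → M ≗₂ N → mutateMatrix k M ≗₂ mutateMatrix k N
mutateMatrix-cong k M≗N i j with k ≟ i | k ≟ j
... | yes _ | _     = cong -_ (M≗N i j)
... | no _  | yes _ = cong -_ (M≗N i j)
... | no _  | no _  = cong₂ _+_ (M≗N i j) (cong₂ exchangeTerm (M≗N i k) (M≗N k j))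

module _ (Q : Quiv n) where

  mat-ascending : ∀ {i j} (i<j : i Fin.< j) → mat Q i j ≡ Q ((i , j) , i<j)
  mat-ascending {i} {j} i<j with Fin.<-cmp i j
  ... | tri< i<j′ _ _ = cong (λ p → Q ((i , j) , p)) (Fin.<-irrelevant i<j′ i<j)
  ... | tri≈ _ i≡j _  = ⊥-elim (Fin.<-irrefl i≡j i<j)
  ... | tri> _ _ j<i  = ⊥-elim (Fin.<-asym i<j j<i)

  mat-descending : ∀ {i j} (j<i : j Fin.< i) → mat Q i j ≡ - Q ((j , i) , j<i)
  mat-descending {i} {j} j<i with Fin.<-cmp i j
  ... | tri< i<j _ _  = ⊥-elim (Fin.<-asym i<j j<i)
  ... | tri≈ _ i≡j _  = ⊥-elim (Fin.<-irrefl (sym i≡j) j<i)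
  ... | tri> _ _ j<i′ = cong (λ p → - Q ((j , i) , p)) (Fin.<-irrelevant j<i′ j<i)

  mat-diag : ∀ i → mat Q i i ≡ 0ℤ
  mat-diag i with Fin.<-cmp i i
  ... | tri< i<i _ _ = ⊥-elim (Fin.<-irrefl refl i<i)
  ... | tri≈ _ _ _   = refl
  ... | tri> _ _ i<i = ⊥-elim (Fin.<-irrefl refl i<i)

  mat-skew : SkewSymmetric (mat Q)
  mat-skew i j with Fin.<-cmp i j
  ... | tri< i<j _ _  = mat-descending i<j
  ... | tri≈ _ refl _ = mat-diag i
  ... | tri> _ _ j<i  = trans (mat-ascending j<i) (sym (neg-involutive _))

mat-cong : ∀ {Q R : Quiv n} → Q ≗ R → mat Q ≗₂ mat R
mat-cong Q≗R i j with Fin.<-cmp i j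
... | tri< _ _ _ = Q≗R _
... | tri≈ _ _ _ = refl
... | tri> _ _ _ = cong -_ (Q≗R _)

mutate≡mutateMatrix : ∀ k (Q : Quiv n) {i j} (i<j : i Fin.< j) →
                      mutate k Q ((i , j) , i<j) ≡ mutateMatrix k (mat Q) i j
mutate≡mutateMatrix k Q {i} {j} _ with k ≟ i | k ≟ j
... | yes _ | _     = refl
... | no _  | yes _ = refl
... | no _  | no _  = refl

module _ (k : Fin n) (Q : Quiv n) where

  mat-mutate : mat (mutate k Q) ≗₂ mutateMatrix k (mat Q)
  mat-mutate i j with Fin.<-cmp i j
  ... | tri< i<j _ _  = mutate≡mutateMatrix k Q i<j
  ... | tri≈ _ refl _ = sym (mutateMatrix-diag k (mat Q) (mat-skew Q) i (mat-diag Q i))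
  ... | tri> _ _ j<i  = begin
    - mutate k Q ((j , i) , j<i)          ≡⟨ cong -_ (mutate≡mutateMatrix k Q j<i) ⟩
    - mutateMatrix k (mat Q) j i          ≡⟨ cong -_ (mutateMatrix-skew k (mat Q) (mat-skew Q) i j) ⟩
    - - mutateMatrix k (mat Q) i j        ≡⟨ neg-involutive _ ⟩
    mutateMatrix k (mat Q) i j            ∎
    where open ≡-Reasoning

  mutate-involutive : mutate k (mutate k Q) ≗ Q
  mutate-involutive ((i , j) , i<j) = begin
    mutate k (mutate k Q) ((i , j) , i<j)        ≡⟨ mutate≡mutateMatrix k (mutate k Q) i<j ⟩
    mutateMatrix k (mat (mutate k Q)) i j        ≡⟨ mutateMatrix-cong k mat-mutate i j ⟩
    mutateMatrix k (mutateMatrix k (mat Q)) i j  ≡⟨ mutateMatrix-involutive k (mat Q) i j ⟩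
    mat Q i j                                    ≡⟨ mat-ascending Q i<j ⟩
    Q ((i , j) , i<j)                            ∎
    where open ≡-Reasoning

mutate-cong : ∀ k {Q R : Quiv n} → Q ≗ R → mutate k Q ≗ mutate k R
mutate-cong k {Q} {R} Q≗R ((i , j) , i<j) = begin
  mutate k Q ((i , j) , i<j)     ≡⟨ mutate≡mutateMatrix k Q i<j ⟩
  mutateMatrix k (mat Q) i j     ≡⟨ mutateMatrix-cong k (mat-cong Q≗R) i j ⟩
  mutateMatrix k (mat R) i j     ≡⟨ mutate≡mutateMatrix k R i<j ⟨
  mutate k R ((i , j) , i<j)     ∎
  where open ≡-Reasoning

substitute : Poly V → (V → Poly W) → Poly W
substitute (var v) σ = σ v
substitute (con c) σ = con c
substitute (p ⊕ q) σ = substitute p σ ⊕ substitute q σ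
substitute (p ⊗ q) σ = substitute p σ ⊗ substitute q σ

eval-substitute : ∀ (p : Poly V) (σ : V → Poly W) x →
                  eval (substitute p σ) x ≡ eval p (λ v → eval (σ v) x)
eval-substitute (var v) σ x = refl
eval-substitute (con c) σ x = refl
eval-substitute (p ⊕ q) σ x = cong₂ _+_ (eval-substitute p σ x) (eval-substitute q σ x)
eval-substitute (p ⊗ q) σ x = cong₂ _*_ (eval-substitute p σ x) (eval-substitute q σ x)

eval-cong : ∀ (p : Poly V) {x y : V → ℤ} → x ≗ y → eval p x ≡ eval p y
eval-cong (var v) x≗y = x≗y v
eval-cong (con c) x≗y = refl
eval-cong (p ⊕ q) x≗y = cong₂ _+_ (eval-cong p x≗y) (eval-cong q x≗y)
eval-cong (p ⊗ q) x≗y = cong₂ _*_ (eval-cong p x≗y) (eval-cong q x≗y)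

matPoly : Fin n → Fin n → Poly (Pair n)
matPoly i j with Fin.<-cmp i j
... | tri< i<j _ _ = var ((i , j) , i<j)
... | tri≈ _ _ _   = con 0ℤ
... | tri> _ _ j<i = con -1ℤ ⊗ var ((j , i) , j<i)

eval-matPoly : ∀ (Q : Quiv n) i j → eval (matPoly i j) Q ≡ mat Q i j
eval-matPoly Q i j with Fin.<-cmp i j
... | tri< _ _ _ = refl
... | tri≈ _ _ _ = refl
... | tri> _ _ _ = -1*i≡-i _

exchangePoly : Bool → Bool → Poly V → Poly V → Poly V
exchangePoly true  true  X Y = X ⊗ Y
exchangePoly false false X Y = con -1ℤ ⊗ (X ⊗ Y)
exchangePoly _     _     _ _ = con 0ℤ

eval-exchangePoly : ∀ b₁ b₂ (X Y : Poly V) x →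
                    eval (exchangePoly b₁ b₂ X Y) x ≡ exchangeTermOfSigns b₁ b₂ (eval X x) (eval Y x)
eval-exchangePoly true  true  X Y x = refl
eval-exchangePoly true  false X Y x = refl
eval-exchangePoly false true  X Y x = refl
eval-exchangePoly false false X Y x = refl

Orientation : ℕ → Set
Orientation n = Fin n → Fin n → Bool

Oriented : Orientation n → Matrix n → Set
Oriented o M = ∀ i j → i ≢ j → Sign (o i j) (M i j)

mutatePoly : Fin n → Orientation n → Pair n → Poly (Pair n)
mutatePoly k o ((i , j) , _) with k ≟ i | k ≟ j
... | yes _ | _     = con -1ℤ ⊗ matPoly i j
... | no _  | yes _ = con -1ℤ ⊗ matPoly i j
... | no _  | no _  = matPoly i j ⊕ exchangePoly (o i k) (o k j) (matPoly i k) (matPoly k j)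

mutate≡eval-mutatePoly : ∀ k o (Q : Quiv n) → Oriented o (mat Q) →
                         ∀ p → mutate k Q p ≡ eval (mutatePoly k o p) Q
mutate≡eval-mutatePoly k o Q oriented ((i , j) , _) with k ≟ i | k ≟ j
... | yes _   | _       = sym (trans (-1*i≡-i _) (cong -_ (eval-matPoly Q i j)))
... | no _    | yes _   = sym (trans (-1*i≡-i _) (cong -_ (eval-matPoly Q i j)))
... | no k≢i  | no k≢j  = begin
  mat Q i j + exchangeTerm (mat Q i k) (mat Q k j)
    ≡⟨ cong (_+_ (mat Q i j))
            (exchangeTerm-sign (o i k) (o k j) (oriented i k (k≢i ∘ sym)) (oriented k j k≢j)) ⟩
  mat Q i j + exchangeTermOfSigns (o i k) (o k j) (mat Q i k) (mat Q k j)
    ≡⟨ cong₂ _+_ (eval-matPoly Q i j)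
             (cong₂ (exchangeTermOfSigns (o i k) (o k j)) (eval-matPoly Q i k) (eval-matPoly Q k j)) ⟨
  eval (matPoly i j) Q + exchangeTermOfSigns (o i k) (o k j) (eval (matPoly i k) Q) (eval (matPoly k j) Q)
    ≡⟨ cong (_+_ (eval (matPoly i j) Q)) (eval-exchangePoly (o i k) (o k j) (matPoly i k) (matPoly k j) Q) ⟨
  eval (matPoly i j ⊕ exchangePoly (o i k) (o k j) (matPoly i k) (matPoly k j)) Q ∎
  where open ≡-Reasoning

Arrow : Matrix n → Fin n → Fin n → Set
Arrow M i j = + 2 ≤ M i j

module _ {M : Matrix n} (skew : SkewSymmetric M) where

  arrow⇒sign-false : ∀ {i j} → Arrow M i j → Sign false (M j i)
  arrow⇒sign-false {i} {j} = subst (+ 2 ≤_) (sym (trans (cong -_ (skew i j)) (neg-involutive (M i j))))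

  sign-false⇒arrow : ∀ {i j} → Sign false (M i j) → Arrow M j i
  sign-false⇒arrow {i} {j} = subst (+ 2 ≤_) (sym (skew i j))

  arrow-asym : ∀ {i j} → Arrow M i j → Arrow M j i → ⊥
  arrow-asym i⇒j j⇒i = sign-exclusive j⇒i (arrow⇒sign-false i⇒j)

  arrow-irrefl : ∀ {i j} → Arrow M i j → i ≢ j
  arrow-irrefl i⇒i refl = arrow-asym i⇒i i⇒i

  arrow-or-reverse : ∀ {o} → Oriented o M → ∀ {i j} → i ≢ j → Arrow M i j ⊎ Arrow M j i
  arrow-or-reverse {o} oriented {i} {j} i≢j with o i j | oriented i j i≢j
  ... | true  | i⇒j = inj₁ i⇒j
  ... | false | j⇒i = inj₂ (sign-false⇒arrow j⇒i)

-- R marks the vertices allowed as points of return: off R there is no oriented 3-cycle, and at a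
-- point of return r each path i → r → j is dominated by the arrow j → i.  For R empty this says
-- that an abundant quiver is acyclic; for R = {r} it is Warkentin's notion of a fork.
ThreeCycleFreeOff : (Fin n → Bool) → Matrix n → Set
ThreeCycleFreeOff R M = ∀ {a b c} → R a ≡ false → R b ≡ false → R c ≡ false →
                        Arrow M a b → Arrow M b c → Arrow M c a → ⊥

ForkInequalitiesAt : (Fin n → Bool) → Matrix n → Set
ForkInequalitiesAt R M = ∀ {r i j} → R r ≡ true → Arrow M i r → Arrow M r j →
                         M i r < M j i × M r j < M j i

Fork : (Fin n → Bool) → Matrix n → Set
Fork R M = ThreeCycleFreeOff R M × ForkInequalitiesAt R M

fork-reverse-arrow : ∀ {R} {M : Matrix n} → ForkInequalitiesAt R M →
                     ∀ {r i j} → R r ≡ true → Arrow M i r → Arrow M r j → Arrow M j i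
fork-reverse-arrow ineq Rr i⇒r r⇒j = ≤-trans i⇒r (<⇒≤ (proj₁ (ineq Rr i⇒r r⇒j)))

singleton : Fin n → Fin n → Bool
singleton k v = does (k ≟ v)

singleton-true : ∀ {k v : Fin n} → singleton k v ≡ true → k ≡ v
singleton-true {k = k} {v} _ with k ≟ v
... | yes k≡v = k≡v

singleton-false : ∀ {k v : Fin n} → singleton k v ≡ false → k ≢ v
singleton-false {k = k} {v} _ with k ≟ v
... | no k≢v = k≢v

pathOrientation : Bool → Bool → Bool → Bool
pathOrientation true  true  _ = true
pathOrientation false false _ = false
pathOrientation _     _     b = b

-- An oriented path i → k → j (or j → k → i) forces the orientation of the edge between i and j;
-- all other edges away from k keep their orientation.
mutateOrientation : Fin n → Orientation n → Orientation n
mutateOrientation k o i j with k ≟ i | k ≟ j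
... | yes _ | _     = not (o i j)
... | no _  | yes _ = not (o i j)
... | no _  | no _  = pathOrientation (o i k) (o k j) (o i j)

module _ {R : Fin n → Bool} {M : Matrix n} (skew : SkewSymmetric M) (fork : Fork R M) where

  fork-no-3-cycle-out-of : ∀ {k a b c} → Arrow M k a → Arrow M k b → Arrow M k c →
                           Arrow M a b → Arrow M b c → Arrow M c a → ⊥
  fork-no-3-cycle-out-of {a = a} {b} {c} k⇒a k⇒b k⇒c a⇒b b⇒c c⇒a with R a in Ra | R b in Rb | R c in Rc
  ... | true  | _     | _     = arrow-asym skew k⇒b (fork-reverse-arrow {R = R} (proj₂ fork) Ra k⇒a a⇒b)
  ... | false | true  | _     = arrow-asym skew k⇒c (fork-reverse-arrow {R = R} (proj₂ fork) Rb k⇒b b⇒c)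
  ... | false | false | true  = arrow-asym skew k⇒a (fork-reverse-arrow {R = R} (proj₂ fork) Rc k⇒c c⇒a)
  ... | false | false | false = proj₁ fork Ra Rb Rc a⇒b b⇒c c⇒a

  fork-no-3-cycle-into : ∀ {k a b c} → Arrow M a k → Arrow M b k → Arrow M c k →
                         Arrow M a b → Arrow M b c → Arrow M c a → ⊥
  fork-no-3-cycle-into {a = a} {b} {c} a⇒k b⇒k c⇒k a⇒b b⇒c c⇒a with R a in Ra | R b in Rb | R c in Rc
  ... | true  | _     | _     = arrow-asym skew c⇒k (fork-reverse-arrow {R = R} (proj₂ fork) Ra c⇒a a⇒k)
  ... | false | true  | _     = arrow-asym skew a⇒k (fork-reverse-arrow {R = R} (proj₂ fork) Rb a⇒b b⇒k)
  ... | false | false | true  = arrow-asym skew b⇒k (fork-reverse-arrow {R = R} (proj₂ fork) Rc b⇒c c⇒k)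
  ... | false | false | false = proj₁ fork Ra Rb Rc a⇒b b⇒c c⇒a

module MutationOfFork
  {R : Fin n → Bool} {o : Orientation n} {M M′ : Matrix n} (k : Fin n)
  (skew : SkewSymmetric M) (M′≗μM : M′ ≗₂ mutateMatrix k M)
  (fork : Fork R M) (oriented : Oriented o M) (k∉R : R k ≡ false)
  where

  skew′ : SkewSymmetric M′
  skew′ i j = trans (M′≗μM j i) (trans (mutateMatrix-skew k M skew i j) (cong -_ (sym (M′≗μM i j))))

  M′-col : ∀ i → M′ i k ≡ M k i
  M′-col i = trans (M′≗μM i k) (trans (mutateMatrix-col k M i) (sym (skew i k)))

  M′-row : ∀ j → M′ k j ≡ M j k
  M′-row j = trans (M′≗μM k j) (trans (mutateMatrix-row k M j) (sym (skew k j)))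

  reversed-out : ∀ {i} → Arrow M k i → Arrow M′ i k
  reversed-out {i} = subst (+ 2 ≤_) (sym (M′-col i))

  reversed-in : ∀ {j} → Arrow M j k → Arrow M′ k j
  reversed-in {j} = subst (+ 2 ≤_) (sym (M′-row j))

  M′-off : ∀ {i j} → k ≢ i → k ≢ j → M′ i j ≡ M i j + exchangeTerm (M i k) (M k j)
  M′-off {i} {j} k≢i k≢j = trans (M′≗μM i j) (mutateMatrix-off k M k≢i k≢j)

  M′-path : ∀ {i j} → Arrow M i k → Arrow M k j → M′ i j ≡ M i j + M i k * M k j
  M′-path {i} {j} i⇒k k⇒j =
    trans (M′-off (arrow-irrefl skew i⇒k ∘ sym) (arrow-irrefl skew k⇒j))
          (cong (_+_ (M i j)) (exchangeTerm-sign true true i⇒k k⇒j))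

  M′-into : ∀ {i j} → Arrow M i k → Arrow M j k → M′ i j ≡ M i j
  M′-into {i} {j} i⇒k j⇒k =
    trans (M′-off (arrow-irrefl skew i⇒k ∘ sym) (arrow-irrefl skew j⇒k ∘ sym))
          (trans (cong (_+_ (M i j)) (exchangeTerm-sign true false i⇒k (arrow⇒sign-false skew j⇒k)))
                 (+-identityʳ (M i j)))

  M′-outof : ∀ {i j} → Arrow M k i → Arrow M k j → M′ i j ≡ M i j
  M′-outof {i} {j} k⇒i k⇒j =
    trans (M′-off (arrow-irrefl skew k⇒i) (arrow-irrefl skew k⇒j))
          (trans (cong (_+_ (M i j)) (exchangeTerm-sign false true (arrow⇒sign-false skew k⇒i) k⇒j))
                 (+-identityʳ (M i j)))

  fork-inequalities-at-k : ∀ {i j} → Arrow M′ i k → Arrow M′ k j →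
                           M′ i k < M′ j i × M′ k j < M′ j i
  fork-inequalities-at-k {i} {j} i⇒k k⇒j =
    subst₂ (λ u v → u < M′ j i × v < M′ j i) (sym (M′-col i)) (sym (M′-row j))
      (subst (λ t → M k i < t × M j k < t) (sym (M′-path j⇒k k⇒i))
        (dominated (arrow-or-reverse skew oriented i≢j)))
    where
    k⇒i : Arrow M k i
    k⇒i = subst (+ 2 ≤_) (M′-col i) i⇒k
    j⇒k : Arrow M j k
    j⇒k = subst (+ 2 ≤_) (M′-row j) k⇒j
    i≢j : i ≢ j
    i≢j refl = arrow-asym skew k⇒i j⇒k
    nonNeg′ : ∀ {x} → + 2 ≤ x → + 0 ≤ x
    nonNeg′ = ≤-trans (+≤+ ℕ.z≤n)
    Dominates : ℤ → Set
    Dominates z = M k i < z + M j k * M k i × M j k < z + M j k * M k i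
    dominated : Arrow M i j ⊎ Arrow M j i → Dominates (M j i)
    dominated (inj₂ j⇒i) =
      subst (λ t → M k i < M j i + t) (*-comm (M k i) (M j k))
            (i<k+i*j (nonNeg′ k⇒i) j⇒k (-i<j k⇒i (nonNeg′ j⇒i))) ,
      i<k+i*j (nonNeg′ j⇒k) k⇒i (-i<j j⇒k (nonNeg′ j⇒i))
    dominated (inj₁ i⇒j) with R i in Ri | R j in Rj
    ... | true | _ =
      let ki<jk , ij<jk = proj₂ fork Ri k⇒i i⇒j
          jk< : M j k < - M i j + M j k * M k i
          jk< = i<k+i*j (nonNeg′ j⇒k) k⇒i (neg-mono-< ij<jk)
      in subst Dominates (sym (skew i j)) (<-trans ki<jk jk< , jk<)
    ... | false | true =
      let ij<ki , jk<ki = proj₂ fork Rj i⇒j j⇒k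
          ki< : M k i < - M i j + M j k * M k i
          ki< = subst (λ t → M k i < - M i j + t) (*-comm (M k i) (M j k))
                      (i<k+i*j (nonNeg′ k⇒i) j⇒k (neg-mono-< ij<ki))
      in subst Dominates (sym (skew i j)) (ki< , <-trans jk<ki ki<)
    ... | false | false = ⊥-elim (proj₁ fork Rj k∉R Ri j⇒k k⇒i i⇒j)

  fork-inequalities′ : ForkInequalitiesAt (singleton k) M′
  fork-inequalities′ {r} Rr with singleton-true {k = k} {r} Rr
  ... | refl = fork-inequalities-at-k

  reverse-arrow′ : ∀ {i j} → Arrow M′ i k → Arrow M′ k j → Arrow M′ j i
  reverse-arrow′ = fork-reverse-arrow {R = singleton k} fork-inequalities′ {r = k} (dec-true (k ≟ k) refl)

  oriented′ : Oriented (mutateOrientation k o) M′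
  oriented′ i j i≢j with k ≟ i | k ≟ j
  ... | yes refl | _ =
    subst (Sign _) (sym (trans (M′≗μM k j) (mutateMatrix-row k M j))) (sign-not (o k j) (oriented k j i≢j))
  ... | no _ | yes refl =
    subst (Sign _) (sym (trans (M′≗μM i k) (mutateMatrix-col k M i))) (sign-not (o i k) (oriented i k i≢j))
  ... | no k≢i | no k≢j with o i k | oriented i k (k≢i ∘ sym) | o k j | oriented k j k≢j
  ...   | true  | i⇒k | true  | k⇒j =
    reverse-arrow′ (reversed-out k⇒j) (reversed-in i⇒k)
  ...   | false | k⇒i | false | j⇒k =
    arrow⇒sign-false skew′ (reverse-arrow′ (reversed-out (sign-false⇒arrow skew k⇒i))
                                           (reversed-in (sign-false⇒arrow skew j⇒k)))
  ...   | true  | i⇒k | false | j⇒k =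
    subst (Sign (o i j)) (sym (M′-into i⇒k (sign-false⇒arrow skew j⇒k))) (oriented i j i≢j)
  ...   | false | k⇒i | true  | k⇒j =
    subst (Sign (o i j)) (sym (M′-outof (sign-false⇒arrow skew k⇒i) k⇒j)) (oriented i j i≢j)

  no-shortcut : ∀ {x y} → Arrow M k x → Arrow M y k → Arrow M′ x y → ⊥
  no-shortcut k⇒x y⇒k x⇒y = arrow-asym skew′ x⇒y (reverse-arrow′ (reversed-out k⇒x) (reversed-in y⇒k))

  threeCycleFree′ : ThreeCycleFreeOff (singleton k) M′
  threeCycleFree′ {a} {b} {c} ka kb kc a⇒b b⇒c c⇒a
    with arrow-or-reverse skew oriented (singleton-false ka)
       | arrow-or-reverse skew oriented (singleton-false kb)
       | arrow-or-reverse skew oriented (singleton-false kc)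
  ... | inj₁ k⇒a | inj₁ k⇒b | inj₁ k⇒c =
    fork-no-3-cycle-out-of skew fork k⇒a k⇒b k⇒c
      (subst (+ 2 ≤_) (M′-outof k⇒a k⇒b) a⇒b)
      (subst (+ 2 ≤_) (M′-outof k⇒b k⇒c) b⇒c)
      (subst (+ 2 ≤_) (M′-outof k⇒c k⇒a) c⇒a)
  ... | inj₂ a⇒k | inj₂ b⇒k | inj₂ c⇒k =
    fork-no-3-cycle-into skew fork a⇒k b⇒k c⇒k
      (subst (+ 2 ≤_) (M′-into a⇒k b⇒k) a⇒b)
      (subst (+ 2 ≤_) (M′-into b⇒k c⇒k) b⇒c)
      (subst (+ 2 ≤_) (M′-into c⇒k a⇒k) c⇒a)
  ... | inj₁ k⇒a | inj₂ b⇒k | _        = no-shortcut k⇒a b⇒k a⇒b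
  ... | inj₁ _   | inj₁ k⇒b | inj₂ c⇒k = no-shortcut k⇒b c⇒k b⇒c
  ... | inj₂ a⇒k | inj₁ _   | inj₁ k⇒c = no-shortcut k⇒c a⇒k c⇒a
  ... | inj₂ _   | inj₁ k⇒b | inj₂ c⇒k = no-shortcut k⇒b c⇒k b⇒c
  ... | inj₂ a⇒k | inj₂ _   | inj₁ k⇒c = no-shortcut k⇒c a⇒k c⇒a

  fork′ : Fork (singleton k) M′
  fork′ = threeCycleFree′ , fork-inequalities′

ascending : Orientation n
ascending i j with Fin.<-cmp i j
... | tri< _ _ _ = true
... | _          = false

module _ {Q : Quiv n} (acyc : Acyc n Q) where

  acyclic-oriented : Oriented ascending (mat Q)
  acyclic-oriented i j i≢j with Fin.<-cmp i j
  ... | tri< _ _ _   = acyc _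
  ... | tri≈ _ i≡j _ = ⊥-elim (i≢j i≡j)
  ... | tri> _ _ _   = subst (+ 2 ≤_) (sym (neg-involutive _)) (acyc _)

  acyclic-arrow-ascends : ∀ {i j} → Arrow (mat Q) i j → i Fin.< j
  acyclic-arrow-ascends {i} {j} i⇒j with Fin.<-cmp i j
  ... | tri< i<j _ _ = i<j
  ... | tri≈ _ _ _   with +≤+ () ← i⇒j
  ... | tri> _ _ _   = ⊥-elim (sign-exclusive (acyc _) i⇒j)

  acyclic-fork : Fork (λ _ → false) (mat Q)
  acyclic-fork = (λ {a} {b} {c} _ _ _ a⇒b b⇒c c⇒a →
                    Fin.<-asym (Fin.<-trans (acyclic-arrow-ascends {a} {b} a⇒b)
                                            (acyclic-arrow-ascends {b} {c} b⇒c))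
                               (acyclic-arrow-ascends {c} {a} c⇒a))
               , λ ()

returnPoints : List (Fin n) → Fin n → Bool
returnPoints []      _ = false
returnPoints (k ∷ _)   = singleton k

orientationOf : List (Fin n) → Orientation n
orientationOf []      = ascending
orientationOf (k ∷ w) = mutateOrientation k (orientationOf w)

-- Mutation histories are kept reduced, most recent mutation first: μ_k μ_k is the identity.
extend : Fin n → List (Fin n) → List (Fin n)
extend k []       = k ∷ []
extend k (k′ ∷ w) with k′ ≟ k
... | yes _ = w
... | no _  = k ∷ k′ ∷ w

data Reachable {n : ℕ} : List (Fin n) → Quiv n → Set where
  acyclic : ∀ {Q} → Acyc n Q → Reachable [] Q
  mutated : ∀ {w k P Q} → Reachable w P → returnPoints w k ≡ false → Q ≗ mutate k P →
            Reachable (k ∷ w) Q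

reachable-cong : ∀ {w} {Q Q′ : Quiv n} → Q ≗ Q′ → Reachable w Q → Reachable w Q′
reachable-cong Q≗Q′ (acyclic acyc)      = acyclic (λ p → subst (+ 2 ≤_) (Q≗Q′ p) (acyc p))
reachable-cong Q≗Q′ (mutated r k∉R Q≗μP) = mutated r k∉R (λ p → trans (sym (Q≗Q′ p)) (Q≗μP p))

reachable-fork : ∀ {w} {Q : Quiv n} → Reachable w Q →
                 Fork (returnPoints w) (mat Q) × Oriented (orientationOf w) (mat Q)
reachable-fork (acyclic acyc) = acyclic-fork acyc , acyclic-oriented acyc
reachable-fork {Q = Q} (mutated {k = k} {P} r k∉R Q≗μP) =
  let fork , oriented = reachable-fork r
      open MutationOfFork k (mat-skew P) matQ≗μmatP fork oriented k∉R
  in fork′ , oriented′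
  where
  matQ≗μmatP : mat Q ≗₂ mutateMatrix k (mat P)
  matQ≗μmatP i j = trans (mat-cong Q≗μP i j) (mat-mutate k P i j)

reachable-mutate : ∀ {w} k {Q : Quiv n} → Reachable w Q → Reachable (extend k w) (mutate k Q)
reachable-mutate {w = []}     k r = mutated r refl (λ _ → refl)
reachable-mutate {w = k′ ∷ w} k r with k′ ≟ k
... | no k′≢k  = mutated r (dec-false (k′ ≟ k) k′≢k) (λ _ → refl)
... | yes refl with r
...   | mutated {P = P} r′ _ Q≗μP =
  reachable-cong (λ p → sym (trans (mutate-cong k Q≗μP p) (mutate-involutive k P p))) r′

mutSeqPoly : List (Fin n) → List (Fin n) → Pair n → Poly (Pair n)
mutSeqPoly w []       p = var p
mutSeqPoly w (k ∷ ks) p = substitute (mutSeqPoly (extend k w) ks p) (mutatePoly k (orientationOf w))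

mutSeqInversePoly : List (Fin n) → List (Fin n) → Pair n → Poly (Pair n)
mutSeqInversePoly w []       p = var p
mutSeqInversePoly w (k ∷ ks) p =
  substitute (mutatePoly k (orientationOf (extend k w)) p) (mutSeqInversePoly (extend k w) ks)

mutSeq≡eval-mutSeqPoly : ∀ ks {w} {Q : Quiv n} → Reachable w Q →
                         ∀ p → mutSeq ks Q p ≡ eval (mutSeqPoly w ks p) Q
mutSeq≡eval-mutSeqPoly []       r p = refl
mutSeq≡eval-mutSeqPoly (k ∷ ks) {w} {Q} r p = begin
  mutSeq ks (mutate k Q) p
    ≡⟨ mutSeq≡eval-mutSeqPoly ks (reachable-mutate k r) p ⟩
  eval (mutSeqPoly (extend k w) ks p) (mutate k Q)
    ≡⟨ eval-cong (mutSeqPoly (extend k w) ks p) (mutate≡eval-mutatePoly k _ Q (proj₂ (reachable-fork r))) ⟩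
  eval (mutSeqPoly (extend k w) ks p) (λ v → eval (mutatePoly k (orientationOf w) v) Q)
    ≡⟨ eval-substitute (mutSeqPoly (extend k w) ks p) (mutatePoly k (orientationOf w)) Q ⟨
  eval (mutSeqPoly w (k ∷ ks) p) Q ∎
  where open ≡-Reasoning

eval-mutSeqInversePoly : ∀ ks {w} {Q : Quiv n} → Reachable w Q →
                         ∀ p → eval (mutSeqInversePoly w ks p) (mutSeq ks Q) ≡ Q p
eval-mutSeqInversePoly []       r p = refl
eval-mutSeqInversePoly (k ∷ ks) {w} {Q} r p = begin
  eval (substitute (mutatePoly k o′ p) (mutSeqInversePoly (extend k w) ks)) (mutSeq ks (mutate k Q))
    ≡⟨ eval-substitute (mutatePoly k o′ p) (mutSeqInversePoly (extend k w) ks) (mutSeq ks (mutate k Q)) ⟩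
  eval (mutatePoly k o′ p) (λ v → eval (mutSeqInversePoly (extend k w) ks v) (mutSeq ks (mutate k Q)))
    ≡⟨ eval-cong (mutatePoly k o′ p) (eval-mutSeqInversePoly ks r′) ⟩
  eval (mutatePoly k o′ p) (mutate k Q)
    ≡⟨ mutate≡eval-mutatePoly k o′ (mutate k Q) (proj₂ (reachable-fork r′)) p ⟨
  mutate k (mutate k Q) p
    ≡⟨ mutate-involutive k Q p ⟩
  Q p ∎
  where
  open ≡-Reasoning
  o′ : Orientation _
  o′ = orientationOf (extend k w)
  r′ : Reachable (extend k w) (mutate k Q)
  r′ = reachable-mutate k r

lemma8p9 : (n : ℕ) → (is : List (Fin n)) →
    ZBiregularOntoImage (Acyc n) (mutSeq is)
lemma8p9 n is =
  mutSeqPoly [] is , mutSeqInversePoly [] is ,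
  (λ Q acyc → mutSeq≡eval-mutSeqPoly is (acyclic acyc)) ,
  (λ Q acyc → eval-mutSeqInversePoly is (acyclic acyc))
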